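{- Let $m\ge 4$ be an integer and $k=5m$. Then $va_3^{\equiv}(K_{4k,4k,4k})\leq 12m-6$.
   Context: All graphs are finite and simple. A $t$-coloring of a graph $G$ is a map $f:V(G)\to\{1,\dots,t\}$, with color classes $V_i=\{v: f(v)=i\}$. It is equitable if $\big||V_i|-|V_j|\big|\le 1$ for all $i,j$. A $(t,k)$-tree-coloring of $G$ is a $t$-coloring such that every connected component of each induced subgraph $G[V_i]$ is a tree of maximum degree at most $k$; an equitable $(t,k)$-tree-coloring is a $(t,k)$-tree-coloring that is equitable. The strong equitable vertex $k$-arboricity $va_k^{\equiv}(G)$ is the smallest integer $t$ such that $G$ has an equitable $(t',k)$-tree-coloring for every integer $t'\ge t$. $K_{n,n,n}$ denotes the complete tripartite graph whose three partite sets each have exactly $n$ vertices. -}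

module Defs where

open import Data.Nat using (ℕ; zero; suc; _+_; _*_; _≤_)
open import Data.Bool using (Bool; true; false; T?; _∧_; not)
open import Data.Fin using (Fin; zero; suc; inject₁; fromℕ; quotient)
open import Data.Fin.Properties using (_≟_)
open import Data.List using (List; length; filter)
open import Data.List using () renaming (allFin to allFinL)
open import Data.Empty using (⊥)
open import Data.Product using (Σ; _×_)
open import Relation.Binary.PropositionalEquality using (_≡_)
open import Relation.Nullary.Decidable using (⌊_⌋)
open import Function.Definitions using (Injective)

record Graph : Set where
  field
    n     : ℕ
    adj   : Fin n → Fin n → Bool
    sym   : ∀ u v → adj u v ≡ adj v u
    irrefl : ∀ v → adj v v ≡ false
open Graph public

count : ∀ {N} → (Fin N → Bool) → ℕ
count {N} p = length (filter (λ u → T? (p u)) (allFinL N))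

Coloring : Graph → ℕ → Set
Coloring G t = Fin (n G) → Fin t

classSize : (G : Graph) {t : ℕ} → Coloring G t → Fin t → ℕ
classSize G f i = count (λ v → ⌊ f v ≟ i ⌋)

Equitable : (G : Graph) {t : ℕ} → Coloring G t → Set
Equitable G f = ∀ i j → classSize G f i ≤ classSize G f j + 1

monoDegree : (G : Graph) {t : ℕ} → Coloring G t → Fin (n G) → ℕ
monoDegree G f v = count (λ u → adj G v u ∧ ⌊ f u ≟ f v ⌋)

-- G[V_i] contains no cycle for every i: there is no injective closed walk
-- c 0, c 1, ..., c (l+2) (length ≥ 3) of vertices of one color class.
MonoAcyclic : (G : Graph) {t : ℕ} → Coloring G t → Set
MonoAcyclic G f =
  ∀ (l : ℕ) (c : Fin (3 + l) → Fin (n G)) →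
  Injective _≡_ _≡_ c →
  (∀ i → f (c i) ≡ f (c zero)) →
  (∀ (i : Fin (2 + l)) → adj G (c (inject₁ i)) (c (suc i)) ≡ true) →
  adj G (c (fromℕ (2 + l))) (c zero) ≡ true →
  ⊥

-- (t,k)-tree-coloring: every component of each G[V_i] is a tree
-- (i.e. G[V_i] is acyclic) of maximum degree at most k.
TreeColoring : (G : Graph) (t k : ℕ) → Coloring G t → Set
TreeColoring G t k f = MonoAcyclic G f × (∀ v → monoDegree G f v ≤ k)

EquitableTreeColorable : (G : Graph) (t k : ℕ) → Set
EquitableTreeColorable G t k =
  Σ (Coloring G t) (λ f → TreeColoring G t k f × Equitable G f)

-- va_k^≡(G) ≤ t  :⇔  G has an equitable (t',k)-tree-coloring for every t' ≥ t
-- (the smallest t with this property is va_k^≡(G), so this is exactly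
--  the inequality va_k^≡(G) ≤ t).
StrongEqVertexArboricity≤ : Graph → (k t : ℕ) → Set
StrongEqVertexArboricity≤ G k t = ∀ t' → t ≤ t' → EquitableTreeColorable G t' k

-- complete tripartite graph K_{p,p,p} on Fin (3 * p);
-- vertex v lies in part  quotient p v : Fin 3
K3 : ℕ → Graph
K3 p = record
  { n = 3 * p
  ; adj = λ u v → not ⌊ quotient p u ≟ quotient p v ⌋
  ; sym = λ u v → symHelper (quotient p u) (quotient p v)
  ; irrefl = λ v → irrHelper (quotient p v)
  }
  where
  open import Relation.Binary.PropositionalEquality using (refl)
  symHelper : (a b : Fin 3) → not ⌊ a ≟ b ⌋ ≡ not ⌊ b ≟ a ⌋
  symHelper zero zero = refl
  symHelper zero (suc zero) = refl
  symHelper zero (suc (suc zero)) = refl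
  symHelper (suc zero) zero = refl
  symHelper (suc zero) (suc zero) = refl
  symHelper (suc zero) (suc (suc zero)) = refl
  symHelper (suc (suc zero)) zero = refl
  symHelper (suc (suc zero)) (suc zero) = refl
  symHelper (suc (suc zero)) (suc (suc zero)) = refl
  irrHelper : (a : Fin 3) → not ⌊ a ≟ a ⌋ ≡ false
  irrHelper zero = refl
  irrHelper (suc zero) = refl
  irrHelper (suc (suc zero)) = refl

-- Number the vertices of K_{p,p,p} (p = 20m) by 0, …, 3p − 1, so that part j is [jp, (j+1)p), and
-- colour them by cutting this sequence into t consecutive intervals, all of length s or s + 1.
-- Such a colouring is equitable, and it is a (t,3)-tree-colouring as soon as every interval either
-- lies inside one part (an independent set) or has at most three vertices: as p ≥ 2, all but at
-- most one of these lie in one part, so they induce a star with at most two edges.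
-- For 12m − 6 ≤ t ≤ 3⌊p/3⌋ each part is cut separately into about t/3 intervals of length q or
-- q + 1, with q = 5, 4 or 3 according to the range of t. For larger t we have t ≥ p − 1, and the
-- balanced cut into intervals of length ⌊3p/t⌋ ≤ 3 or one more works: when ⌊3p/t⌋ = 3, at most
-- three intervals have length 4, and they lie at the start of the first part.

module Submission where

open import Data.Bool using (Bool; true; T; T?; not; _∧_)
open import Data.Bool.Properties using (T-≡; T-∧)
open import Data.Empty using (⊥; ⊥-elim)
open import Data.Fin using (Fin; zero; suc; toℕ; fromℕ<; fromℕ; quotient; remainder; combine)
open import Data.Fin.Properties
  using (toℕ-fromℕ<; toℕ-injective; toℕ<n; injective⇒≤; fromℕ<-injective; combine-remQuot; toℕ-combine)
  renaming (_≟_ to _≟ᶠ_)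
open import Data.List using (List; []; _∷_; lookup; filter; length)
open import Data.List using () renaming (allFin to allFinL)
open import Data.List.Membership.Propositional using (_∈_)
open import Data.List.Membership.Propositional.Properties using (∈-filter⁺; ∈-filter⁻; ∈-lookup; ∈-allFin)
open import Data.List.Relation.Unary.All as All using ()
open import Data.List.Relation.Unary.AllPairs using (_∷_)
open import Data.List.Relation.Unary.Any as Any using ()
open import Data.List.Relation.Unary.Any.Properties using (lookup-index)
open import Data.List.Relation.Unary.Unique.Propositional using (Unique)
import Data.List.Relation.Unary.Unique.Propositional.Properties as Unique
open import Data.Nat
open import Data.Nat.Properties
open import Data.Nat.DivMod
open import Data.Nat.Tactic.RingSolver using (solve)
open import Data.Product using (Σ; _×_; _,_; proj₁; proj₂)
open import Data.Sum using (_⊎_; inj₁; inj₂; [_,_])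
open import Function using (case_of_)
open import Function.Bundles using (Equivalence)
open import Function.Definitions using (Injective)
open import Relation.Nullary using (Dec; yes; no)
open import Relation.Binary using (tri<; tri≈; tri>)
open import Relation.Nullary.Decidable using (⌊_⌋; toWitness; fromWitness)
open import Relation.Binary.PropositionalEquality
  using (_≡_; _≢_; refl; sym; trans; cong; subst; subst₂; module ≡-Reasoning)

open import Defs hiding (sym)

Unique⇒lookup-injective : ∀ {A : Set} {xs : List A} → Unique xs →
  ∀ i j → lookup xs i ≡ lookup xs j → i ≡ j
Unique⇒lookup-injective (_  ∷ _) zero    zero    _ = refl
Unique⇒lookup-injective (x∉ ∷ _) zero    (suc j) e = ⊥-elim (All.lookup x∉ (∈-lookup j) e)
Unique⇒lookup-injective (x∉ ∷ _) (suc i) zero    e = ⊥-elim (All.lookup x∉ (∈-lookup i) (sym e))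
Unique⇒lookup-injective (_  ∷ u) (suc i) (suc j) e = cong suc (Unique⇒lookup-injective u i j e)

module _ {N : ℕ} (P : Fin N → Bool) where

  private
    P? = λ u → T? (P u)
    satisfiers = filter P? (allFinL N)

  count≤ : ∀ {k} (h : Fin N → ℕ) → (∀ u → T (P u) → h u < k) →
    (∀ u v → T (P u) → T (P v) → h u ≡ h v → u ≡ v) → count P ≤ k
  count≤ h h<k h-inj = injective⇒≤ {f = F} F-injective
    where
    holds : ∀ i → T (P (lookup satisfiers i))
    holds i = proj₂ (∈-filter⁻ P? {xs = allFinL N} (∈-lookup i))
    F : Fin (length satisfiers) → Fin _
    F i = fromℕ< (h<k _ (holds i))
    F-injective : Injective _≡_ _≡_ F
    F-injective {i} {j} e = Unique⇒lookup-injective (Unique.filter⁺ P? (Unique.allFin⁺ N)) i j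
      (h-inj _ _ (holds i) (holds j) (fromℕ<-injective _ _ _ _ e))

  ≤count : ∀ {k} (g : Fin k → Fin N) → (∀ i → T (P (g i))) → Injective _≡_ _≡_ g → k ≤ count P
  ≤count g holds g-inj = injective⇒≤ {f = G} G-injective
    where
    g∈ : ∀ i → g i ∈ satisfiers
    g∈ i = ∈-filter⁺ P? (∈-allFin (g i)) (holds i)
    G : _ → Fin (length satisfiers)
    G i = Any.index (g∈ i)
    G-injective : Injective _≡_ _≡_ G
    G-injective {i} {j} e =
      g-inj (trans (lookup-index (g∈ i)) (trans (cong (lookup satisfiers) e) (sym (lookup-index (g∈ j)))))

  count≤interval : ∀ {L R} → (∀ u → T (P u) → L ≤ toℕ u × toℕ u < R) → count P ≤ R ∸ L
  count≤interval {L} within = count≤ (λ u → toℕ u ∸ L)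
    (λ u Pu → ∸-monoˡ-< (proj₂ (within u Pu)) (proj₁ (within u Pu)))
    (λ u v Pu Pv e → toℕ-injective (∸-cancelʳ-≡ (proj₁ (within u Pu)) (proj₁ (within v Pv)) e))

  interval≤count : ∀ {L R} → R ≤ N → (∀ u → L ≤ toℕ u → toℕ u < R → T (P u)) → R ∸ L ≤ count P
  interval≤count {L} {R} R≤N inside with L ≤? R
  ... | no L≰R = subst (_≤ count P) (sym (m≤n⇒m∸n≡0 (<⇒≤ (≰⇒> L≰R)))) z≤n
  ... | yes L≤R = ≤count g (λ i → inside (g i) (g-lower i) (g-upper i)) g-injective
    where
    L+i<R : ∀ (i : Fin (R ∸ L)) → L + toℕ i < R
    L+i<R i = subst (L + toℕ i <_) (m+[n∸m]≡n L≤R) (+-monoʳ-< L (toℕ<n i))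
    g : Fin (R ∸ L) → Fin N
    g i = fromℕ< (<-≤-trans (L+i<R i) R≤N)
    g-lower : ∀ i → L ≤ toℕ (g i)
    g-lower i = subst (L ≤_) (sym (toℕ-fromℕ< _)) (m≤m+n L (toℕ i))
    g-upper : ∀ i → toℕ (g i) < R
    g-upper i = subst (_< R) (sym (toℕ-fromℕ< _)) (L+i<R i)
    g-injective : Injective _≡_ _≡_ g
    g-injective e = toℕ-injective (+-cancelˡ-≡ L _ _ (fromℕ<-injective _ _ _ _ e))

/-between : ∀ n .{{_ : NonZero n}} {v j} → j * n ≤ v → v < suc j * n → v / n ≡ j
/-between n {v} {j} lower upper =
  ≤-antisym (≤-pred (m<n*o⇒m/o<n upper)) (subst (_≤ v / n) (m*n/n≡m j n) (/-monoˡ-≤ n lower))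

toℕ-quotient : ∀ {m} n .{{_ : NonZero n}} (i : Fin (m * n)) → toℕ (quotient {m} n i) ≡ toℕ i / n
toℕ-quotient {m} n i = sym (/-between n lower upper)
  where
  q = toℕ (quotient {m} n i)
  r = toℕ (remainder {m} n i)
  i≡q*n+r : toℕ i ≡ q * n + r
  i≡q*n+r = begin
    toℕ i                                                ≡⟨ cong toℕ (sym (combine-remQuot {m} n i)) ⟩
    toℕ (combine (quotient {m} n i) (remainder {m} n i)) ≡⟨ toℕ-combine (quotient {m} n i) _ ⟩
    n * q + r                                            ≡⟨ cong (_+ r) (*-comm n q) ⟩
    q * n + r                                            ∎
    where open ≡-Reasoning
  lower : q * n ≤ toℕ i
  lower = subst (q * n ≤_) (sym i≡q*n+r) (m≤m+n (q * n) r)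
  upper : toℕ i < suc q * n
  upper = subst₂ _<_ (sym i≡q*n+r) (+-comm (q * n) n) (+-monoʳ-< (q * n) (toℕ<n (remainder {m} n i)))

K3-adjacent⇒parts-differ : ∀ p .{{_ : NonZero p}} (u v : Fin (3 * p)) →
  adj (K3 p) u v ≡ true → toℕ u / p ≢ toℕ v / p
K3-adjacent⇒parts-differ p u v uv same with quotient {3} p u ≟ᶠ quotient p v
... | yes _     = case uv of λ ()
... | no differ = differ (toℕ-injective (trans (toℕ-quotient p u) (trans same (sym (toℕ-quotient p v)))))

-- Centre i says that c i is the centre of a star, which happens for at most one i: a cycle
-- c 0, …, c (2 + l) cannot have each of its edges c 0 c 1, c 1 c 2 and c (2 + l) c 0 at the centre.
cycle-not-star : ∀ {l} (Centre : Fin (3 + l) → Set) → (∀ i j → Centre i → Centre j → i ≡ j) →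
  Centre zero ⊎ Centre (suc zero) → Centre (suc zero) ⊎ Centre (suc (suc zero)) →
  Centre (fromℕ (2 + l)) ⊎ Centre zero → ⊥
cycle-not-star {l} Centre unique e01 e12 closing = star e01 e12
  where
  not-1 : Centre (suc zero) → ⊥
  not-1 c1 = [ (λ cl → case unique _ (suc zero) cl c1 of λ ())
             , (λ c0 → case unique zero (suc zero) c0 c1 of λ ()) ] closing
  star : Centre zero ⊎ Centre (suc zero) → Centre (suc zero) ⊎ Centre (suc (suc zero)) → ⊥
  star (inj₂ c1) _         = not-1 c1
  star _         (inj₁ c1) = not-1 c1
  star (inj₁ c0) (inj₂ c2) = case unique zero (suc (suc zero)) c0 c2 of λ ()

-- Vertex v of K3 p lies in part toℕ v / p (toℕ-quotient); vertex sets are intervals [L, R) of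
-- these numbers.
module _ (p : ℕ) {{_ : NonZero p}} where

  InOnePart : ℕ → ℕ → Set
  InOnePart L R = Σ ℕ λ P → ∀ v → L ≤ v → v < R → v / p ≡ P

  AlmostInOnePart : ℕ → ℕ → Set
  AlmostInOnePart L R = Σ ℕ λ P → Σ ℕ λ x → ∀ v → L ≤ v → v < R → v / p ≡ P ⊎ v ≡ x

  Admissible : ℕ → ℕ → Set
  Admissible L R = R ≤ L + 3 ⊎ InOnePart L R

  Step : ℕ → ℕ → ℕ → Set
  Step s L R = L + s ≤ R × R ≤ suc (L + s) × Admissible L R

  Steps : ℕ → ℕ → (ℕ → ℕ) → Set
  Steps s n B = ∀ c → c < n → Step s (B c) (B (suc c))

  [m+2]/p≤1+m/p : 2 ≤ p → ∀ m → (m + 2) / p ≤ suc (m / p)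
  [m+2]/p≤1+m/p 2≤p m = begin
    (m + 2) / p           ≤⟨ /-monoˡ-≤ p (+-monoʳ-≤ m 2≤p) ⟩
    (m + p) / p           ≡⟨ m/n≡1+[m∸n]/n (m≤n+m p m) ⟩
    suc ((m + p ∸ p) / p) ≡⟨ cong (λ x → suc (x / p)) (m+n∸n≡m m p) ⟩
    suc (m / p)           ∎
    where open ≤-Reasoning

  three-consecutive : 2 ≤ p → ∀ L →
    Σ ℕ λ P → Σ ℕ λ x → ∀ v → L ≤ v → v ≤ L + 2 → v / p ≡ P ⊎ v ≡ x
  three-consecutive 2≤p L with L / p ≟ (L + 1) / p
  ... | yes same = L / p , L + 2 , member
    where
    member : ∀ v → L ≤ v → v ≤ L + 2 → v / p ≡ L / p ⊎ v ≡ L + 2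
    member v lo hi with v ≤? L + 1
    ... | yes v≤L+1 = inj₁ (≤-antisym (subst (v / p ≤_) (sym same) (/-monoˡ-≤ p v≤L+1)) (/-monoˡ-≤ p lo))
    ... | no v≰L+1  = inj₂ (≤-antisym hi (subst (_≤ v) (sym (+-suc L 1)) (≰⇒> v≰L+1)))
  ... | no differ = (L + 1) / p , L , member
    where
    L/p<[L+1]/p : L / p < (L + 1) / p
    L/p<[L+1]/p = ≤∧≢⇒< (/-monoˡ-≤ p (m≤m+n L 1)) differ
    member : ∀ v → L ≤ v → v ≤ L + 2 → v / p ≡ (L + 1) / p ⊎ v ≡ L
    member v lo hi with v ≤? L
    ... | yes v≤L = inj₂ (≤-antisym v≤L lo)
    ... | no v≰L  = inj₁ (≤-antisym
          (≤-trans (/-monoˡ-≤ p hi) (≤-trans ([m+2]/p≤1+m/p 2≤p L) L/p<[L+1]/p))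
          (/-monoˡ-≤ p (subst (_≤ v) (+-comm 1 L) (≰⇒> v≰L))))

  admissible⇒almostInOnePart : 2 ≤ p → ∀ {L R} → Admissible L R → AlmostInOnePart L R
  admissible⇒almostInOnePart _ (inj₂ (P , inP)) = P , 0 , λ v lo hi → inj₁ (inP v lo hi)
  admissible⇒almostInOnePart 2≤p {L} {R} (inj₁ R≤L+3) with three-consecutive 2≤p L
  ... | P , x , member = P , x , λ v lo hi →
    member v lo (m<1+n⇒m≤n (subst (v <_) (+-suc L 2) (<-≤-trans hi R≤L+3)))

module IntervalColouring (p : ℕ) {{_ : NonZero p}} (2≤p : 2 ≤ p) {s t₀ : ℕ} {B : ℕ → ℕ}
  (B-0 : B 0 ≡ 0) (B-t : B (suc t₀) ≡ 3 * p) (steps : Steps p s (suc t₀) B) where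

  G : Graph
  G = K3 p

  t : ℕ
  t = suc t₀

  B-mono : ∀ {c d} → c ≤ d → d ≤ t → B c ≤ B d
  B-mono {d = zero} z≤n _ = ≤-refl
  B-mono {c} {suc d} c≤1+d 1+d≤t with m≤n⇒m<n∨m≡n c≤1+d
  ... | inj₂ refl   = ≤-refl
  ... | inj₁ c<1+d = ≤-trans (B-mono (≤-pred c<1+d) (<⇒≤ 1+d≤t)) (m+n≤o⇒m≤o _ (proj₁ (steps d 1+d≤t)))

  intervalIndex : ℕ → ℕ → ℕ
  intervalIndex v zero = zero
  intervalIndex v (suc c) with B (suc c) ≤? v
  ... | yes _ = suc c
  ... | no _  = intervalIndex v c

  intervalIndex≤ : ∀ v c → intervalIndex v c ≤ c
  intervalIndex≤ v zero = z≤n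
  intervalIndex≤ v (suc c) with B (suc c) ≤? v
  ... | yes _ = ≤-refl
  ... | no _  = m≤n⇒m≤1+n (intervalIndex≤ v c)

  B-intervalIndex≤ : ∀ v c → B (intervalIndex v c) ≤ v
  B-intervalIndex≤ v zero = subst (_≤ v) (sym B-0) z≤n
  B-intervalIndex≤ v (suc c) with B (suc c) ≤? v
  ... | yes B≤v = B≤v
  ... | no _    = B-intervalIndex≤ v c

  <B-suc-intervalIndex : ∀ v c → v < B (suc c) → v < B (suc (intervalIndex v c))
  <B-suc-intervalIndex v zero v<B = v<B
  <B-suc-intervalIndex v (suc c) v<B with B (suc c) ≤? v
  ... | yes _  = v<B
  ... | no B≰v = <B-suc-intervalIndex v c (≰⇒> B≰v)

  interval-unique : ∀ {v c d} → c < t → d < t →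
    B c ≤ v → v < B (suc c) → B d ≤ v → v < B (suc d) → c ≡ d
  interval-unique {c = c} {d} c<t d<t Bc≤v v<Bc' Bd≤v v<Bd' with <-cmp c d
  ... | tri≈ _ c≡d _ = c≡d
  ... | tri< c<d _ _ = ⊥-elim (<⇒≱ v<Bc' (≤-trans (B-mono c<d (<⇒≤ d<t)) Bd≤v))
  ... | tri> _ _ d<c = ⊥-elim (<⇒≱ v<Bd' (≤-trans (B-mono d<c (<⇒≤ c<t)) Bc≤v))

  colour : Coloring G t
  colour v = fromℕ< (s≤s (intervalIndex≤ (toℕ v) t₀))

  InClass : Fin t → Fin (3 * p) → Set
  InClass i u = B (toℕ i) ≤ toℕ u × toℕ u < B (suc (toℕ i))

  colour-class : ∀ u → InClass (colour u) u
  colour-class u rewrite toℕ-fromℕ< (s≤s (intervalIndex≤ (toℕ u) t₀)) =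
    B-intervalIndex≤ (toℕ u) t₀ , <B-suc-intervalIndex (toℕ u) t₀ (subst (toℕ u <_) (sym B-t) (toℕ<n u))

  class-colour : ∀ u i → InClass i u → colour u ≡ i
  class-colour u i (lo , hi) = toℕ-injective
    (interval-unique (toℕ<n (colour u)) (toℕ<n i) (proj₁ (colour-class u)) (proj₂ (colour-class u)) lo hi)

  same-colour⇒class : ∀ u i → colour u ≡ i → InClass i u
  same-colour⇒class u i refl = colour-class u

  class-size-lower : ∀ i → s ≤ classSize G colour i
  class-size-lower i = ≤-trans (m+n≤o⇒m≤o∸n s (subst (_≤ B (suc (toℕ i))) (+-comm _ s) width-lower))
    (interval≤count _ (subst (B (suc (toℕ i)) ≤_) B-t (B-mono (toℕ<n i) ≤-refl))
      (λ u lo hi → fromWitness (class-colour u i (lo , hi))))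
    where width-lower = proj₁ (steps (toℕ i) (toℕ<n i))

  class-size-upper : ∀ i → classSize G colour i ≤ suc s
  class-size-upper i = ≤-trans (count≤interval _ (λ u e → same-colour⇒class u i (toWitness e)))
    (m≤n+o⇒m∸n≤o _ _ (subst (B (suc (toℕ i)) ≤_) (sym (+-suc _ s)) width-upper))
    where width-upper = proj₁ (proj₂ (steps (toℕ i) (toℕ<n i)))

  equitable : Equitable G colour
  equitable i j = ≤-trans (class-size-upper i)
    (subst (_≤ classSize G colour j + 1) (+-comm s 1) (+-monoˡ-≤ 1 (class-size-lower j)))

  class-admissible : ∀ i → Admissible p (B (toℕ i)) (B (suc (toℕ i)))
  class-admissible i = proj₂ (proj₂ (steps (toℕ i) (toℕ<n i)))

  degree≤3 : ∀ v → monoDegree G colour v ≤ 3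
  degree≤3 v = bound (class-admissible (colour v))
    where
    split : ∀ u → T (adj G v u ∧ ⌊ colour u ≟ᶠ colour v ⌋) →
      T (adj G v u) × T ⌊ colour u ≟ᶠ colour v ⌋
    split u = Equivalence.to (T-∧ {adj G v u})
    neighbour-in-class : ∀ u → T (adj G v u ∧ ⌊ colour u ≟ᶠ colour v ⌋) → InClass (colour v) u
    neighbour-in-class u e = same-colour⇒class u _ (toWitness (proj₂ (split u e)))
    bound : Admissible p (B (toℕ (colour v))) (B (suc (toℕ (colour v)))) → monoDegree G colour v ≤ 3
    bound (inj₁ short) = ≤-trans (count≤interval _ neighbour-in-class) (m≤n+o⇒m∸n≤o _ _ short)
    bound (inj₂ (P , inP)) = ≤-trans (count≤ _ (λ _ → 0) (λ u e → ⊥-elim (no-neighbour u e))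
                                        (λ u _ e _ _ → ⊥-elim (no-neighbour u e))) z≤n
      where
      part-P : ∀ u → InClass (colour v) u → toℕ u / p ≡ P
      part-P u (lo , hi) = inP (toℕ u) lo hi
      no-neighbour : ∀ u → T (adj G v u ∧ ⌊ colour u ≟ᶠ colour v ⌋) → ⊥
      no-neighbour u e = K3-adjacent⇒parts-differ p v u (Equivalence.to T-≡ (proj₁ (split u e)))
        (trans (part-P v (colour-class v)) (sym (part-P u (neighbour-in-class u e))))

  acyclic : MonoAcyclic G colour
  acyclic l c c-injective same-colour edge closing =
    cycle-not-star (λ j → toℕ (c j) ≡ x) (λ _ _ e e′ → c-injective (toℕ-injective (trans e (sym e′))))
      (centre (edge zero)) (centre (edge (suc zero))) (centre closing)
    where
    almost = admissible⇒almostInOnePart p 2≤p (class-admissible (colour (c zero)))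
    P = proj₁ almost
    x = proj₁ (proj₂ almost)
    side : ∀ j → toℕ (c j) / p ≡ P ⊎ toℕ (c j) ≡ x
    side j with same-colour⇒class (c j) _ (same-colour j)
    ... | lo , hi = proj₂ (proj₂ almost) (toℕ (c j)) lo hi
    centre : ∀ {j j′} → adj G (c j) (c j′) ≡ true → toℕ (c j) ≡ x ⊎ toℕ (c j′) ≡ x
    centre {j} {j′} a with side j | side j′
    ... | inj₂ e | _      = inj₁ e
    ... | _      | inj₂ e = inj₂ e
    ... | inj₁ e | inj₁ e′ = ⊥-elim (K3-adjacent⇒parts-differ p _ _ a (trans e (sym e′)))

  colourable : EquitableTreeColorable G t 3
  colourable = colour , (acyclic , degree≤3) , equitable

steps⇒colourable : ∀ p {{_ : NonZero p}} → 2 ≤ p → ∀ {s t B} →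
  B 0 ≡ 0 → B t ≡ 3 * p → Steps p s t B → EquitableTreeColorable (K3 p) t 3
steps⇒colourable p (s≤s (s≤s _)) {t = zero} B-0 B-t _ = case trans (sym B-t) B-0 of λ ()
steps⇒colourable p 2≤p {t = suc _} B-0 B-t steps = IntervalColouring.colourable p 2≤p B-0 B-t steps

-- boundaries of c consecutive intervals, the first r of length q + 1 and the rest of length q
balanced : ℕ → ℕ → ℕ → ℕ
balanced q r c = c ⊓ r + c * q

balanced-mono : ∀ q r {c d} → c ≤ d → balanced q r c ≤ balanced q r d
balanced-mono q r c≤d = +-mono-≤ (⊓-monoˡ-≤ r c≤d) (*-monoˡ-≤ q c≤d)

balanced-end : ∀ q {r n} → r ≤ n → balanced q r n ≡ r + n * q
balanced-end q {n = n} r≤n = cong (_+ n * q) (m≥n⇒m⊓n≡n r≤n)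

private
  +-shuffle : ∀ a b q → a + b + q ≡ a + (q + b)
  +-shuffle a b q = trans (+-assoc a b q) (cong (a +_) (+-comm b q))

balanced-step-lower : ∀ q r c → balanced q r c + q ≤ balanced q r (suc c)
balanced-step-lower q r c = subst (_≤ balanced q r (suc c)) (sym (+-shuffle (c ⊓ r) (c * q) q))
  (+-monoˡ-≤ (q + c * q) (⊓-monoˡ-≤ r (n≤1+n c)))

balanced-step-upper : ∀ q r c → balanced q r (suc c) ≤ suc (balanced q r c + q)
balanced-step-upper q r c = subst (balanced q r (suc c) ≤_) (cong suc (sym (+-shuffle (c ⊓ r) (c * q) q)))
  (+-monoˡ-≤ (q + c * q) (⊓-monoʳ-≤ (suc c) (n≤1+n r)))

balanced-step-past : ∀ q {r c} → r ≤ c → balanced q r (suc c) ≡ balanced q r c + q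
balanced-step-past q {r} {c} r≤c = begin
  suc c ⊓ r + (q + c * q) ≡⟨ cong (_+ (q + c * q)) (m≥n⇒m⊓n≡n (m≤n⇒m≤1+n r≤c)) ⟩
  r + (q + c * q)         ≡⟨ cong (_+ (q + c * q)) (sym (m≥n⇒m⊓n≡n r≤c)) ⟩
  c ⊓ r + (q + c * q)     ≡⟨ sym (+-shuffle (c ⊓ r) (c * q) q) ⟩
  c ⊓ r + c * q + q       ∎
  where open ≡-Reasoning

balanced-steps : ∀ p {{_ : NonZero p}} q r {n} →
  (∀ c → c < n → Admissible p (balanced q r c) (balanced q r (suc c))) → Steps p q n (balanced q r)
balanced-steps p q r admissible c c<n =
  balanced-step-lower q r c , balanced-step-upper q r c , admissible c c<n

join : ℕ → (ℕ → ℕ) → (ℕ → ℕ) → ℕ → ℕ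
join n B B′ c with c ≤? n
... | yes _ = B c
... | no _  = B′ (c ∸ n)

join-left : ∀ {n B B′ c} → c ≤ n → join n B B′ c ≡ B c
join-left {n} {c = c} c≤n with c ≤? n
... | yes _  = refl
... | no c≰n = ⊥-elim (c≰n c≤n)

join-right : ∀ {n B B′ c} → B n ≡ B′ 0 → n ≤ c → join n B B′ c ≡ B′ (c ∸ n)
join-right {n} {B} {B′} {c} meet n≤c with c ≤? n
... | no _ = refl
... | yes c≤n with ≤-antisym c≤n n≤c
...   | refl = trans meet (cong B′ (sym (n∸n≡0 n)))

join-steps : ∀ p {{_ : NonZero p}} {s n n′ B B′} → B n ≡ B′ 0 → Steps p s n B → Steps p s n′ B′ →
  Steps p s (n + n′) (join n B B′)
join-steps p {s = s} {n} {n′} {B} {B′} meet steps steps′ c c<n+n′ with <-≤-connex c n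
... | inj₁ c<n = subst₂ (Step p s) (sym (join-left (<⇒≤ c<n))) (sym (join-left c<n)) (steps c c<n)
... | inj₂ n≤c = subst₂ (Step p s) (sym (join-right meet n≤c)) (sym join-suc) (steps′ (c ∸ n) c∸n<n′)
  where
  c∸n<n′ : c ∸ n < n′
  c∸n<n′ = subst (c ∸ n <_) (m+n∸m≡n n n′) (∸-monoˡ-< c<n+n′ n≤c)
  join-suc : join n B B′ (suc c) ≡ B′ (suc (c ∸ n))
  join-suc = trans (join-right meet (m≤n⇒m≤1+n n≤c)) (cong B′ (+-∸-assoc 1 n≤c))

module _ (p : ℕ) {{_ : NonZero p}} (q : ℕ) where

  Tiles : ℕ → Set
  Tiles n = q * n ≤ p × p ≤ q * n + n

  block : ℕ → ℕ → ℕ → ℕ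
  block j n c = j * p + balanced q (p ∸ q * n) c

  balanced-tiles : ∀ {n} → Tiles n → balanced q (p ∸ q * n) n ≡ p
  balanced-tiles {n} (lower , upper) = begin
    balanced q (p ∸ q * n) n ≡⟨ balanced-end q (m≤n+o⇒m∸n≤o p (q * n) upper) ⟩
    p ∸ q * n + n * q        ≡⟨ cong (p ∸ q * n +_) (*-comm n q) ⟩
    p ∸ q * n + q * n        ≡⟨ m∸n+n≡m lower ⟩
    p                        ∎
    where open ≡-Reasoning

  block-start : ∀ j n → block j n 0 ≡ j * p
  block-start j n = +-identityʳ (j * p)

  block-end : ∀ j {n} → Tiles n → block j n n ≡ suc j * p
  block-end j tiles = trans (cong (j * p +_) (balanced-tiles tiles)) (+-comm (j * p) p)

  block-steps : ∀ j {n} → Tiles n → Steps p q n (block j n)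
  block-steps j {n} tiles c c<n = lower , upper , inj₂ (j , inside)
    where
    β = balanced q (p ∸ q * n)
    lower : block j n c + q ≤ block j n (suc c)
    lower = subst (_≤ block j n (suc c)) (sym (+-assoc (j * p) (β c) q))
      (+-monoʳ-≤ (j * p) (balanced-step-lower q _ c))
    upper : block j n (suc c) ≤ suc (block j n c + q)
    upper = subst (block j n (suc c) ≤_) (trans (+-suc (j * p) _) (cong suc (sym (+-assoc (j * p) (β c) q))))
      (+-monoʳ-≤ (j * p) (balanced-step-upper q _ c))
    inside : ∀ v → block j n c ≤ v → v < block j n (suc c) → v / p ≡ j
    inside v lo hi = /-between p (≤-trans (m≤m+n (j * p) _) lo)
      (<-≤-trans hi (subst (block j n (suc c) ≤_) (block-end j tiles)
        (+-monoʳ-≤ (j * p) (balanced-mono q _ c<n))))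

  threeBlocks-colourable : 2 ≤ p → ∀ {c₀ c₁ c₂} → Tiles c₀ → Tiles c₁ → Tiles c₂ →
    EquitableTreeColorable (K3 p) (c₀ + (c₁ + c₂)) 3
  threeBlocks-colourable 2≤p {c₀} {c₁} {c₂} tiles₀ tiles₁ tiles₂ =
    steps⇒colourable p 2≤p {B = scheme} start end
    (join-steps p meet₀ (block-steps 0 tiles₀) (join-steps p meet₁ (block-steps 1 tiles₁) (block-steps 2 tiles₂)))
    where
    tail = join c₁ (block 1 c₁) (block 2 c₂)
    scheme = join c₀ (block 0 c₀) tail
    meet₁ : block 1 c₁ c₁ ≡ block 2 c₂ 0
    meet₁ = trans (block-end 1 tiles₁) (sym (block-start 2 c₂))
    meet₀ : block 0 c₀ c₀ ≡ tail 0
    meet₀ = trans (block-end 0 tiles₀)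
      (trans (sym (block-start 1 c₁)) (sym (join-left {c₁} {block 1 c₁} {block 2 c₂} z≤n)))
    start : scheme 0 ≡ 0
    start = trans (join-left {c₀} {block 0 c₀} {tail} z≤n) (block-start 0 c₀)
    end : scheme (c₀ + (c₁ + c₂)) ≡ 3 * p
    end = begin
      scheme (c₀ + (c₁ + c₂))                    ≡⟨ join-right meet₀ (m≤m+n c₀ _) ⟩
      tail (c₀ + (c₁ + c₂) ∸ c₀)                 ≡⟨ cong tail (m+n∸m≡n c₀ _) ⟩
      tail (c₁ + c₂)                             ≡⟨ join-right meet₁ (m≤m+n c₁ c₂) ⟩
      block 2 c₂ (c₁ + c₂ ∸ c₁)                  ≡⟨ cong (block 2 c₂) (m+n∸m≡n c₁ c₂) ⟩
      block 2 c₂ c₂                              ≡⟨ block-end 2 tiles₂ ⟩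
      3 * p                                      ∎
      where open ≡-Reasoning

Between : ℕ → ℕ → ℕ → Set
Between L U c = L ≤ c × c ≤ U

private
  a+[a+a]≡a*3 : ∀ a → a + (a + a) ≡ a * 3
  a+[a+a]≡a*3 a = trans (cong (λ x → a + (a + x)) (sym (+-identityʳ a))) (*-comm 3 a)

  thirds-lower : ∀ {L a e} → e < 3 → 3 * L ≤ e + a * 3 → L ≤ a
  thirds-lower {L} {a} e<3 3L≤ = m<1+n⇒m≤n (*-cancelʳ-< 3 L (suc a)
    (subst (_< suc a * 3) (*-comm 3 L) (≤-<-trans 3L≤ (+-monoˡ-< (a * 3) e<3))))

  thirds-upper : ∀ {U a} → a * 3 ≤ 3 * U → a ≤ U
  thirds-upper {U} {a} ≤3U = *-cancelʳ-≤ a U 3 (subst (a * 3 ≤_) (*-comm 3 U) ≤3U)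

  thirds-upper-strict : ∀ {U a} → a * 3 < 3 * U → a < U
  thirds-upper-strict {U} {a} <3U = *-cancelʳ-< 3 a U (subst (a * 3 <_) (*-comm 3 U) <3U)

split-evenly : ∀ {L U a e t} → t ≡ e + a * 3 → e < 3 → 3 * L ≤ t → t ≤ 3 * U →
  Σ ℕ λ c₀ → Σ ℕ λ c₁ → Σ ℕ λ c₂ →
    c₀ + (c₁ + c₂) ≡ t × Between L U c₀ × Between L U c₁ × Between L U c₂
split-evenly {a = a} {0} refl e<3 3L≤t t≤3U = a , a , a , a+[a+a]≡a*3 a , in-range , in-range , in-range
  where in-range = thirds-lower e<3 3L≤t , thirds-upper t≤3U
split-evenly {a = a} {1} refl e<3 3L≤t t≤3U = suc a , a , a , cong suc (a+[a+a]≡a*3 a) ,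
  (m≤n⇒m≤1+n L≤a , a<U) , (L≤a , <⇒≤ a<U) , (L≤a , <⇒≤ a<U)
  where L≤a = thirds-lower e<3 3L≤t
        a<U = thirds-upper-strict t≤3U
split-evenly {a = a} {2} refl e<3 3L≤t t≤3U = suc a , suc a , a ,
  cong suc (trans (+-suc a (a + a)) (cong suc (a+[a+a]≡a*3 a))) ,
  (m≤n⇒m≤1+n L≤a , a<U) , (m≤n⇒m≤1+n L≤a , a<U) , (L≤a , <⇒≤ a<U)
  where L≤a = thirds-lower e<3 3L≤t
        a<U = thirds-upper-strict (<⇒≤ t≤3U)
split-evenly {e = suc (suc (suc _))} _ (s≤s (s≤s (s≤s ()))) _ _

pure-colourable : ∀ p {{_ : NonZero p}} → 2 ≤ p → ∀ q L U {t} → q * U ≤ p → p ≤ q * L + L →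
  3 * L ≤ t → t ≤ 3 * U → EquitableTreeColorable (K3 p) t 3
pure-colourable p 2≤p q L U {t} q*U≤p p≤q*L+L 3L≤t t≤3U
  with split-evenly {a = t / 3} (m≡m%n+[m/n]*n t 3) (m%n<n t 3) 3L≤t t≤3U
... | c₀ , c₁ , c₂ , sum , in₀ , in₁ , in₂ = subst (λ t → EquitableTreeColorable (K3 p) t 3) sum
  (threeBlocks-colourable p q 2≤p (tiles in₀) (tiles in₁) (tiles in₂))
  where
  tiles : ∀ {c} → Between L U c → Tiles p q c
  tiles (L≤c , c≤U) =
    ≤-trans (*-monoʳ-≤ q c≤U) q*U≤p , ≤-trans p≤q*L+L (+-mono-≤ (*-monoʳ-≤ q L≤c) L≤c)

large-colourable : ∀ p {{_ : NonZero p}} → 12 ≤ p → ∀ t → p ≤ suc t → EquitableTreeColorable (K3 p) t 3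
large-colourable p 12≤p t p≤1+t = steps⇒colourable p (≤-trans (s≤s (s≤s z≤n)) 12≤p) {B = β}
  refl end (balanced-steps p q r admissible)
  where
  11≤t : 11 ≤ t
  11≤t = ≤-pred (≤-trans 12≤p p≤1+t)
  instance
    t≢0 : NonZero t
    t≢0 = >-nonZero (≤-trans (s≤s z≤n) 11≤t)
  q = 3 * p / t
  r = 3 * p % t
  β = balanced q r
  division : r + q * t ≡ 3 * p
  division = sym (m≡m%n+[m/n]*n (3 * p) t)
  end : β t ≡ 3 * p
  end = trans (balanced-end q (<⇒≤ (m%n<n (3 * p) t))) (trans (cong (r +_) (*-comm t q)) division)
  r+qt≤3+3t : r + q * t ≤ 3 + 3 * t
  r+qt≤3+3t = subst (_≤ 3 + 3 * t) (sym division) (subst (3 * p ≤_) (*-suc 3 t) (*-monoʳ-≤ 3 p≤1+t))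
  q≤3 : q ≤ 3
  q≤3 = m<1+n⇒m≤n (*-cancelʳ-< t q 4
    (≤-<-trans (m+n≤o⇒n≤o r r+qt≤3+3t) (+-monoˡ-< (3 * t) (≤-trans (m≤m+n 4 7) 11≤t))))
  r≤3 : 3 ≤ q → r ≤ 3
  r≤3 3≤q = +-cancelʳ-≤ (3 * t) r 3 (≤-trans (+-monoʳ-≤ r (*-monoˡ-≤ t 3≤q)) r+qt≤3+3t)
  admissible : ∀ c → c < t → Admissible p (β c) (β (suc c))
  admissible c _ with q ≤? 2 | r ≤? c
  ... | yes q≤2 | _ = inj₁ (≤-trans (balanced-step-upper q r c)
        (subst (_≤ β c + 3) (+-suc (β c) q) (+-monoʳ-≤ (β c) (s≤s q≤2))))
  ... | no _ | yes r≤c = inj₁ (subst (_≤ β c + 3) (sym (balanced-step-past q r≤c)) (+-monoʳ-≤ (β c) q≤3))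
  -- here q = 3, so r ≤ 3 and the r intervals of length 4 end by 12 ≤ p, inside the first part
  ... | no q≰2 | no r≰c = inj₂ (0 , λ v _ v<β → m<n⇒m/n≡0 (<-≤-trans v<β β[1+c]≤p))
    where
    β[1+c]≤p : β (suc c) ≤ p
    β[1+c]≤p = ≤-trans (balanced-mono q r (≰⇒> r≰c)) (≤-trans
      (+-mono-≤ (≤-trans (m⊓n≤m r r) (r≤3 (≰⇒> q≰2))) (*-mono-≤ (r≤3 (≰⇒> q≰2)) q≤3)) 12≤p)

3[m/3]<n⇒m≤1+n : ∀ m {n} → 3 * (m / 3) < n → m ≤ suc n
3[m/3]<n⇒m≤1+n m {n} 3[m/3]<n = m<1+n⇒m≤n (begin-strict
  m                 ≡⟨ m≡m%n+[m/n]*n m 3 ⟩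
  m % 3 + m / 3 * 3 ≤⟨ +-mono-≤ (m<1+n⇒m≤n (m%n<n m 3)) (≤-reflexive (*-comm (m / 3) 3)) ⟩
  2 + 3 * (m / 3)   <⟨ +-monoʳ-< 2 3[m/3]<n ⟩
  2 + n             ∎)
  where open ≤-Reasoning

K3[80+20k]-colourable : ∀ k t → 42 + 12 * k ≤ t → EquitableTreeColorable (K3 (80 + 20 * k)) t 3
K3[80+20k]-colourable k t 42+12k≤t =
  by-range (t ≤? 3 * (16 + 4 * k)) (t ≤? 3 * (20 + 5 * k)) (t ≤? 3 * (p / 3))
  where
  p = 80 + 20 * k
  12≤p : 12 ≤ p
  12≤p = ≤-trans (m≤m+n 12 68) (m≤m+n 80 (20 * k))
  2≤p : 2 ≤ p
  2≤p = ≤-trans (m≤m+n 2 10) 12≤p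
  p≤6[14+4k] : p ≤ 5 * (14 + 4 * k) + (14 + 4 * k)
  p≤6[14+4k] = begin
    80 + 20 * k                     ≤⟨ +-mono-≤ (m≤m+n 80 4) (*-monoˡ-≤ k (m≤m+n 20 4)) ⟩
    84 + 24 * k                     ≡⟨ solve (k ∷ []) ⟩
    5 * (14 + 4 * k) + (14 + 4 * k) ∎
    where open ≤-Reasoning
  5[16+4k]≡p : 5 * (16 + 4 * k) ≡ 80 + 20 * k
  5[16+4k]≡p = solve (k ∷ [])
  3[14+4k]≡42+12k : 3 * (14 + 4 * k) ≡ 42 + 12 * k
  3[14+4k]≡42+12k = solve (k ∷ [])
  4[20+5k]≡p : 4 * (20 + 5 * k) ≡ 80 + 20 * k
  4[20+5k]≡p = solve (k ∷ [])
  p≡5[16+4k] : 80 + 20 * k ≡ 4 * (16 + 4 * k) + (16 + 4 * k)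
  p≡5[16+4k] = solve (k ∷ [])
  p≡4[20+5k] : 80 + 20 * k ≡ 3 * (20 + 5 * k) + (20 + 5 * k)
  p≡4[20+5k] = solve (k ∷ [])
  by-range : Dec (t ≤ 3 * (16 + 4 * k)) → Dec (t ≤ 3 * (20 + 5 * k)) → Dec (t ≤ 3 * (p / 3)) →
    EquitableTreeColorable (K3 p) t 3
  by-range (yes t≤3U) _ _ = pure-colourable p 2≤p 5 (14 + 4 * k) (16 + 4 * k)
    (≤-reflexive 5[16+4k]≡p) p≤6[14+4k] (subst (_≤ t) (sym 3[14+4k]≡42+12k) 42+12k≤t) t≤3U
  by-range (no t≰3L) (yes t≤3U) _ = pure-colourable p 2≤p 4 (16 + 4 * k) (20 + 5 * k)
    (≤-reflexive 4[20+5k]≡p) (≤-reflexive p≡5[16+4k]) (<⇒≤ (≰⇒> t≰3L)) t≤3U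
  by-range (no _) (no t≰3L) (yes t≤3U) = pure-colourable p 2≤p 3 (20 + 5 * k) (p / 3)
    (≤-trans (≤-reflexive (*-comm 3 (p / 3))) (m/n*n≤m p 3)) (≤-reflexive p≡4[20+5k])
    (<⇒≤ (≰⇒> t≰3L)) t≤3U
  by-range (no _) (no _) (no t≰3[p/3]) = large-colourable p 12≤p t (3[m/3]<n⇒m≤1+n p (≰⇒> t≰3[p/3]))

lemma8 : ∀ (m : ℕ) → 4 ≤ m →
    StrongEqVertexArboricity≤ (K3 (4 * (5 * m))) 3 (12 * m ∸ 6)
lemma8 m 4≤m t 12m∸6≤t with m ∸ 4 | m+[n∸m]≡n 4≤m
... | k | refl = subst (λ p → EquitableTreeColorable (K3 p) t 3) (sym p≡80+20k)
  (K3[80+20k]-colourable k t (subst (_≤ t) (cong (_∸ 6) 12m≡48+12k) 12m∸6≤t))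
  where
  p≡80+20k : 4 * (5 * (4 + k)) ≡ 80 + 20 * k
  p≡80+20k = solve (k ∷ [])
  12m≡48+12k : 12 * (4 + k) ≡ 48 + 12 * k
  12m≡48+12k = solve (k ∷ [])
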